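{- Let $k$ be a positive integer and $d\ge 0$. Every graph with chromatic number at most $k$ and minimum degree $d$ has a bipartite induced subgraph of minimum degree at least $d/(2k)$.
   Context: All graphs are finite and simple. -}

module Defs where

open import Data.Nat using (ℕ; _≤_; _*_)
open import Data.Fin using (Fin)
open import Data.Bool using (Bool; true; false; _∧_; if_then_else_)
open import Data.List using (List; length; filter; allFin)
open import Data.Product using (Σ; _×_; ∃)
open import Relation.Binary.PropositionalEquality using (_≡_; _≢_)
open import Relation.Nullary using (¬_)
open import Data.Bool.Properties using (T?)

record Graph (n : ℕ) : Set where
  field
    adj   : Fin n → Fin n → Bool
    sym   : ∀ u v → adj u v ≡ adj v u
    irrefl : ∀ v → adj v v ≡ false
open Graph public

VSet : ℕ → Set
VSet n = Fin n → Bool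

degIn : ∀ {n} → Graph n → VSet n → Fin n → ℕ
degIn G S v = length (filter (λ u → T? (S u ∧ adj G v u)) (allFin _))

deg : ∀ {n} → Graph n → Fin n → ℕ
deg G v = degIn G (λ _ → true) v

HasMinDegree : ∀ {n} → Graph n → ℕ → Set
HasMinDegree G d = (∀ v → d ≤ deg G v) × ∃ (λ v → deg G v ≡ d)

ProperColouring : ∀ {n} → Graph n → (k : ℕ) → (Fin n → Fin k) → Set
ProperColouring G k c = ∀ u v → adj G u v ≡ true → c u ≢ c v

ChromaticAtMost : ∀ {n} → Graph n → ℕ → Set
ChromaticAtMost {n} G k = Σ (Fin n → Fin k) (ProperColouring G k)

NonemptySet : ∀ {n} → VSet n → Set
NonemptySet S = ∃ (λ v → S v ≡ true)

InducedBipartite : ∀ {n} → Graph n → VSet n → Set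
InducedBipartite {n} G S =
  Σ (Fin n → Bool) (λ side → ∀ u v → S u ≡ true → S v ≡ true →
     adj G u v ≡ true → side u ≢ side v)

-- The subgraph induced by S has minimum degree at least d/(2k),
-- i.e. every vertex v of S satisfies d ≤ 2k · deg_S(v).
InducedMinDegAtLeastFrac : ∀ {n} → Graph n → VSet n → ℕ → ℕ → Set
InducedMinDegAtLeastFrac G S d k =
  ∀ v → S v ≡ true → d ≤ (2 * k) * degIn G S v

-- Fix a proper k-colouring and, for each ordered pair (i, j) of colours, let P i j be the
-- set of vertices coloured i or j; it induces a bipartite graph. Summed over the k² pairs,
-- every vertex is counted 2k − 1 times, while every edge lies inside at least two of the
-- P i j (namely P x y and P y x for its end colours x ≠ y). Hence some P i j satisfies
-- d · |P i j| < k · (degree sum of G[P i j]), i.e. its average degree exceeds d/k.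
-- Deleting a vertex of degree below d/(2k) lowers the degree sum by less than d/k and
-- so preserves this inequality; peeling such vertices off one at a time must stop at a
-- nonempty set all of whose vertices have degree at least d/(2k).

module Submission where

open import Defs hiding (sym)
open import Data.Nat hiding (_≟_)
open import Data.Nat.Properties hiding (_≟_)
open import Data.Nat.Solver using (module +-*-Solver)
open import Data.Bool using (Bool; true; false; _∧_; _∨_; not)
import Data.Bool as Bool
open import Data.Bool.Properties using (T?; ∧-identityʳ)
open import Data.Fin using (Fin; zero; suc; _≟_)
open import Data.Fin.Properties using (any?; nonZeroIndex)
open import Data.List using (length; filter; tabulate)
open import Data.Product using (Σ; _×_; ∃; ∃₂; _,_)
open import Function using (_∘_; id)
open import Relation.Binary.PropositionalEquality
open import Relation.Nullary using (does; yes; no; contradiction)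
open import Relation.Nullary.Decidable using (_×-dec_; dec-true)
open import Algebra.Properties.Semiring.Sum +-*-semiring
  using (sum; sum-syntax; sum-cong-≗; sum-replicate-zero; ∑-distrib-+; ∑-comm; *-distribˡ-sum)

open +-*-Solver

∑-mono-≤ : ∀ {n} {f g : Fin n → ℕ} → (∀ i → f i ≤ g i) → ∑[ i < n ] f i ≤ ∑[ i < n ] g i
∑-mono-≤ {zero}  f≤g = z≤n
∑-mono-≤ {suc n} f≤g = +-mono-≤ (f≤g zero) (∑-mono-≤ (f≤g ∘ suc))

∑-const : ∀ n c → ∑[ i < n ] c ≡ n * c
∑-const zero    c = refl
∑-const (suc n) c = cong (c +_) (∑-const n c)

term≤∑ : ∀ {n} (f : Fin n → ℕ) i → f i ≤ ∑[ j < n ] f j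
term≤∑ f zero    = m≤m+n _ _
term≤∑ f (suc i) = ≤-trans (term≤∑ (f ∘ suc) i) (m≤n+m _ _)

two-terms≤∑ : ∀ {n} (f : Fin n → ℕ) {i j} → i ≢ j → f i + f j ≤ ∑[ l < n ] f l
two-terms≤∑ f {zero}  {zero}  i≢j = contradiction refl i≢j
two-terms≤∑ f {zero}  {suc j} _   = +-monoʳ-≤ (f zero) (term≤∑ (f ∘ suc) j)
two-terms≤∑ f {suc i} {zero}  _   =
  subst (_≤ f zero + sum (f ∘ suc)) (+-comm (f zero) (f (suc i))) (+-monoʳ-≤ (f zero) (term≤∑ (f ∘ suc) i))
two-terms≤∑ f {suc i} {suc j} i≢j =
  ≤-trans (two-terms≤∑ (f ∘ suc) (i≢j ∘ cong suc)) (m≤n+m _ _)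

∑-<⇒∃-< : ∀ {n} (f g : Fin n → ℕ) → ∑[ i < n ] f i < ∑[ i < n ] g i → ∃ λ i → f i < g i
∑-<⇒∃-< {suc n} f g ∑f<∑g with f zero <? g zero
... | yes f₀<g₀ = zero , f₀<g₀
... | no  f₀≮g₀ with ∑-<⇒∃-< (f ∘ suc) (g ∘ suc)
                       (+-cancelˡ-< (f zero) _ _ (<-≤-trans ∑f<∑g (+-monoˡ-≤ _ (≮⇒≥ f₀≮g₀))))
...   | i , fi<gi = suc i , fi<gi

∑²-<⇒∃-< : ∀ {m n} (f g : Fin m → Fin n → ℕ) →
  ∑[ i < m ] ∑[ j < n ] f i j < ∑[ i < m ] ∑[ j < n ] g i j → ∃₂ λ i j → f i j < g i j
∑²-<⇒∃-< f g ∑²f<∑²g with ∑-<⇒∃-< _ _ ∑²f<∑²g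
... | i , ∑fi<∑gi with ∑-<⇒∃-< (f i) (g i) ∑fi<∑gi
...   | j , fij<gij = i , j , fij<gij

*-distribˡ-∑² : ∀ {m n} c (f : Fin m → Fin n → ℕ) →
  c * ∑[ i < m ] ∑[ j < n ] f i j ≡ ∑[ i < m ] ∑[ j < n ] (c * f i j)
*-distribˡ-∑² c f = trans (*-distribˡ-sum c (λ i → sum (f i))) (sum-cong-≗ λ i → *-distribˡ-sum c (f i))

∑-comm-∑² : ∀ {m n p} (f : Fin m → Fin n → Fin p → ℕ) →
  ∑[ i < m ] ∑[ j < n ] ∑[ a < p ] f i j a ≡ ∑[ a < p ] ∑[ i < m ] ∑[ j < n ] f i j a
∑-comm-∑² f = trans (sum-cong-≗ λ i → ∑-comm (f i)) (∑-comm λ i a → sum λ j → f i j a)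

term≤∑² : ∀ {m n} (f : Fin m → Fin n → ℕ) i j → f i j ≤ ∑[ i < m ] ∑[ j < n ] f i j
term≤∑² f i j = ≤-trans (term≤∑ (f i) j) (term≤∑ (λ i → sum (f i)) i)

∑²-distrib-+ : ∀ {m n} (f g : Fin m → Fin n → ℕ) →
  ∑[ i < m ] ∑[ j < n ] (f i j + g i j) ≡ ∑[ i < m ] ∑[ j < n ] f i j + ∑[ i < m ] ∑[ j < n ] g i j
∑²-distrib-+ f g = trans (sum-cong-≗ λ i → ∑-distrib-+ (f i) (g i)) (∑-distrib-+ (λ i → sum (f i)) (λ i → sum (g i)))

𝟙 : Bool → ℕ
𝟙 true  = 1
𝟙 false = 0

𝟙-∧ : ∀ p q → 𝟙 (p ∧ q) ≡ 𝟙 p * 𝟙 q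
𝟙-∧ true  q = sym (+-identityʳ (𝟙 q))
𝟙-∧ false q = refl

𝟙-∨+𝟙-∧ : ∀ p q → 𝟙 (p ∨ q) + 𝟙 (p ∧ q) ≡ 𝟙 p + 𝟙 q
𝟙-∨+𝟙-∧ true  true  = refl
𝟙-∨+𝟙-∧ true  false = refl
𝟙-∨+𝟙-∧ false q     = +-identityʳ (𝟙 q)

δ : ∀ {n} → Fin n → Fin n → ℕ
δ i j = 𝟙 (does (i ≟ j))

∑-δ : ∀ {n} i (f : Fin n → ℕ) → ∑[ j < n ] (δ i j * f j) ≡ f i
∑-δ {suc n} zero    f = trans (cong₂ _+_ (+-identityʳ (f zero)) (sum-replicate-zero n)) (+-identityʳ (f zero))
∑-δ {suc n} (suc i) f = ∑-δ i (f ∘ suc)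

∑-δ-count : ∀ {n} (i : Fin n) → ∑[ j < n ] δ i j ≡ 1
∑-δ-count i = trans (sum-cong-≗ λ j → sym (*-identityʳ (δ i j))) (∑-δ i (λ _ → 1))

length-filter-tabulate : ∀ {A : Set} {n} (p : A → Bool) (f : Fin n → A) →
  length (filter (T? ∘ p) (tabulate f)) ≡ ∑[ i < n ] 𝟙 (p (f i))
length-filter-tabulate {n = zero}  p f = refl
length-filter-tabulate {n = suc n} p f with p (f zero)
... | true  = cong suc (length-filter-tabulate p (f ∘ suc))
... | false = length-filter-tabulate p (f ∘ suc)

covers : ∀ {k} → Fin k → Fin k → Fin k → Bool
covers i j x = does (x ≟ i) ∨ does (x ≟ j)

covers-left : ∀ {k} (i j : Fin k) → covers i j i ≡ true
covers-left i j rewrite dec-true (i ≟ i) refl = refl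

covers-right : ∀ {k} (i j : Fin k) → covers i j j ≡ true
covers-right i j with j ≟ i
... | yes _ = refl
... | no  _ rewrite dec-true (j ≟ j) refl = refl

covers-same-side⇒≡ : ∀ {k} {i j x y : Fin k} → covers i j x ≡ true → covers i j y ≡ true →
  does (x ≟ i) ≡ does (y ≟ i) → x ≡ y
covers-same-side⇒≡ {i = i} {j} {x} {y} cx cy same with x ≟ i | y ≟ i | x ≟ j | y ≟ j
covers-same-side⇒≡ cx cy same  | yes refl | yes refl | _        | _        = refl
covers-same-side⇒≡ cx cy ()    | yes _    | no _     | _        | _
covers-same-side⇒≡ cx cy ()    | no _     | yes _    | _        | _
covers-same-side⇒≡ cx cy same  | no _     | no _     | yes refl | yes refl = refl
covers-same-side⇒≡ () cy same  | no _     | no _     | no _     | _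
covers-same-side⇒≡ cx () same  | no _     | no _     | _        | no _

∑²-covers+1≤ : ∀ {k} (x : Fin k) → ∑[ i < k ] ∑[ j < k ] 𝟙 (covers i j x) + 1 ≤ 2 * k
∑²-covers+1≤ {k} x = begin
  ∑[ i < k ] ∑[ j < k ] 𝟙 (covers i j x) + 1
    ≤⟨ +-monoʳ-≤ (∑[ i < k ] ∑[ j < k ] 𝟙 (covers i j x)) 1≤∑²both ⟩
  ∑[ i < k ] ∑[ j < k ] 𝟙 (covers i j x) + ∑[ i < k ] ∑[ j < k ] both i j
    ≡⟨ ∑²-distrib-+ (λ i j → 𝟙 (covers i j x)) both ⟨
  ∑[ i < k ] ∑[ j < k ] (𝟙 (covers i j x) + both i j)
    ≡⟨ sum-cong-≗ (λ i → sum-cong-≗ λ j → 𝟙-∨+𝟙-∧ (does (x ≟ i)) (does (x ≟ j))) ⟩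
  ∑[ i < k ] ∑[ j < k ] (δ x i + δ x j)
    ≡⟨ ∑²-distrib-+ (λ i _ → δ x i) (λ _ j → δ x j) ⟩
  ∑[ i < k ] ∑[ j < k ] δ x i + ∑[ i < k ] ∑[ j < k ] δ x j
    ≡⟨ cong₂ _+_ (trans (∑-comm {k} {k} (λ i _ → δ x i)) each-row) each-row ⟩
  k * 1 + k * 1
    ≡⟨ solve 1 (λ k → k :* con 1 :+ k :* con 1 := con 2 :* k) refl k ⟩
  2 * k ∎
  where
  open ≤-Reasoning
  both : Fin k → Fin k → ℕ
  both i j = 𝟙 (does (x ≟ i) ∧ does (x ≟ j))
  diagonal : both x x ≡ 1
  diagonal rewrite dec-true (x ≟ x) refl = refl
  1≤∑²both : 1 ≤ ∑[ i < k ] ∑[ j < k ] both i j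
  1≤∑²both = subst (_≤ ∑[ i < k ] ∑[ j < k ] both i j) diagonal (term≤∑² both x x)
  each-row : ∑[ i < k ] ∑[ j < k ] δ x j ≡ k * 1
  each-row = trans (sum-cong-≗ {k} λ _ → ∑-δ-count x) (∑-const k 1)

∑²-covers-both : ∀ {k} {x y : Fin k} → x ≢ y →
  2 ≤ ∑[ i < k ] ∑[ j < k ] (𝟙 (covers i j x) * 𝟙 (covers i j y))
∑²-covers-both {k} {x} {y} x≢y = begin
  2                     ≡⟨ two ⟨
  f x y + f y x         ≤⟨ +-mono-≤ (term≤∑ (f x) y) (term≤∑ (f y) x) ⟩
  sum (f x) + sum (f y) ≤⟨ two-terms≤∑ (λ i → sum (f i)) x≢y ⟩
  ∑[ i < k ] ∑[ j < k ] f i j ∎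
  where
  open ≤-Reasoning
  f : Fin k → Fin k → ℕ
  f i j = 𝟙 (covers i j x) * 𝟙 (covers i j y)
  two : f x y + f y x ≡ 2
  two rewrite covers-left x y | covers-right x y | covers-right y x | covers-left y x = refl

_⊆_ : ∀ {n} → VSet n → VSet n → Set
S ⊆ T = ∀ u → S u ≡ true → T u ≡ true

_∖_ : ∀ {n} → VSet n → Fin n → VSet n
(S ∖ v) u = S u ∧ not (does (v ≟ u))

∖-⊆ : ∀ {n} (S : VSet n) v → (S ∖ v) ⊆ S
∖-⊆ S v u with S u
... | true  = λ _ → refl
... | false = id

𝟙-∖ : ∀ {n} (S : VSet n) v → S v ≡ true → ∀ u → 𝟙 (S u) ≡ 𝟙 ((S ∖ v) u) + δ v u
𝟙-∖ S v Sv u with v ≟ u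
... | yes refl rewrite Sv = refl
... | no  _    = sym (trans (+-identityʳ _) (cong 𝟙 (∧-identityʳ (S u))))

module _ {n} (G : Graph n) where

  size : VSet n → ℕ
  size S = ∑[ u < n ] 𝟙 (S u)

  degreeSum : VSet n → ℕ
  degreeSum S = ∑[ u < n ] (𝟙 (S u) * degIn G S u)

  degIn-∑ : ∀ S v → degIn G S v ≡ ∑[ u < n ] (𝟙 (S u) * 𝟙 (adj G v u))
  degIn-∑ S v = trans (length-filter-tabulate (λ u → S u ∧ adj G v u) id)
                      (sum-cong-≗ λ u → 𝟙-∧ (S u) (adj G v u))

  size-∖ : ∀ S v → S v ≡ true → size S ≡ suc (size (S ∖ v))
  size-∖ S v Sv = begin
    size S                                         ≡⟨ sum-cong-≗ (𝟙-∖ S v Sv) ⟩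
    ∑[ u < n ] (𝟙 ((S ∖ v) u) + δ v u)             ≡⟨ ∑-distrib-+ (𝟙 ∘ (S ∖ v)) (δ v) ⟩
    size (S ∖ v) + ∑[ u < n ] δ v u                ≡⟨ cong (size (S ∖ v) +_) (∑-δ-count v) ⟩
    size (S ∖ v) + 1                               ≡⟨ +-comm (size (S ∖ v)) 1 ⟩
    suc (size (S ∖ v))                             ∎
    where open ≡-Reasoning

  degIn-∖ : ∀ S v → S v ≡ true → ∀ u → degIn G S u ≡ degIn G (S ∖ v) u + 𝟙 (adj G u v)
  degIn-∖ S v Sv u = begin
    degIn G S u
      ≡⟨ degIn-∑ S u ⟩
    ∑[ w < n ] (𝟙 (S w) * 𝟙 (adj G u w))
      ≡⟨ sum-cong-≗ (λ w → trans (cong (_* 𝟙 (adj G u w)) (𝟙-∖ S v Sv w))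
                                 (*-distribʳ-+ (𝟙 (adj G u w)) (𝟙 ((S ∖ v) w)) (δ v w))) ⟩
    ∑[ w < n ] (𝟙 ((S ∖ v) w) * 𝟙 (adj G u w) + δ v w * 𝟙 (adj G u w))
      ≡⟨ ∑-distrib-+ (λ w → 𝟙 ((S ∖ v) w) * 𝟙 (adj G u w)) (λ w → δ v w * 𝟙 (adj G u w)) ⟩
    ∑[ w < n ] (𝟙 ((S ∖ v) w) * 𝟙 (adj G u w)) + ∑[ w < n ] (δ v w * 𝟙 (adj G u w))
      ≡⟨ cong₂ _+_ (sym (degIn-∑ (S ∖ v) u)) (∑-δ v (𝟙 ∘ adj G u)) ⟩
    degIn G (S ∖ v) u + 𝟙 (adj G u v) ∎
    where open ≡-Reasoning

  degreeSum-∖ : ∀ S v → S v ≡ true → degreeSum S ≡ degreeSum (S ∖ v) + 2 * degIn G S v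
  degreeSum-∖ S v Sv = begin
    degreeSum S
      ≡⟨ sum-cong-≗ (λ u → cong₂ _*_ (𝟙-∖ S v Sv u) (degIn-∖ S v Sv u)) ⟩
    ∑[ u < n ] ((x u + δ v u) * (D u + a u))
      ≡⟨ sum-cong-≗ (λ u → expand (x u) (δ v u) (D u) (a u)) ⟩
    ∑[ u < n ] (x u * D u + (x u * a u + δ v u * (D u + a u)))
      ≡⟨ ∑-distrib-+ (λ u → x u * D u) _ ⟩
    degreeSum S′ + ∑[ u < n ] (x u * a u + δ v u * (D u + a u))
      ≡⟨ cong (degreeSum S′ +_) (∑-distrib-+ (λ u → x u * a u) _) ⟩
    degreeSum S′ + (∑[ u < n ] (x u * a u) + ∑[ u < n ] (δ v u * (D u + a u)))
      ≡⟨ cong (degreeSum S′ +_) (cong₂ _+_ edges-to-v (∑-δ v (λ u → D u + a u))) ⟩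
    degreeSum S′ + (D v + (D v + a v))
      ≡⟨ cong (λ z → degreeSum S′ + (D v + (D v + z))) no-loop ⟩
    degreeSum S′ + 2 * D v
      ≡⟨ cong (λ z → degreeSum S′ + 2 * z) (sym degIn-v) ⟩
    degreeSum S′ + 2 * degIn G S v ∎
    where
    open ≡-Reasoning
    S′ = S ∖ v
    x D a : Fin n → ℕ
    x u = 𝟙 (S′ u)
    D u = degIn G S′ u
    a u = 𝟙 (adj G u v)

    expand : ∀ p q r s → (p + q) * (r + s) ≡ p * r + (p * s + q * (r + s))
    expand = solve 4 (λ p q r s → (p :+ q) :* (r :+ s) := p :* r :+ (p :* s :+ q :* (r :+ s))) refl

    no-loop : a v ≡ 0
    no-loop = cong 𝟙 (irrefl G v)

    edges-to-v : ∑[ u < n ] (x u * a u) ≡ D v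
    edges-to-v = trans (sum-cong-≗ λ u → cong (λ b → x u * 𝟙 b) (Graph.sym G u v)) (sym (degIn-∑ S′ v))

    degIn-v : degIn G S v ≡ D v
    degIn-v = trans (degIn-∖ S v Sv v) (trans (cong (D v +_) no-loop) (+-identityʳ (D v)))

  dense⇒nonempty : ∀ k d S → d * size S < k * degreeSum S → NonemptySet S
  dense⇒nonempty k d S dense with ∑-<⇒∃-< (λ _ → 0) (λ u → 𝟙 (S u) * degIn G S u) 0<degreeSum
    where
    0<degreeSum : sum {n} (λ _ → 0) < degreeSum S
    0<degreeSum = subst (_< degreeSum S) (sym (sum-replicate-zero n))
      (*-cancelˡ-< k 0 (degreeSum S) (subst (_< k * degreeSum S) (sym (*-zeroʳ k)) (≤-<-trans z≤n dense)))
  ... | u , 0<deg-u with S u in Su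
  ...   | true = u , Su

  dense-∖ : ∀ k d S v → S v ≡ true → (2 * k) * degIn G S v < d →
            d * size S < k * degreeSum S → d * size (S ∖ v) < k * degreeSum (S ∖ v)
  dense-∖ k d S v Sv low dense = +-cancelʳ-< d (d * s) (k * e) (begin-strict
    d * s + d            ≡⟨ +-comm (d * s) d ⟩
    d + d * s            ≡⟨ *-suc d s ⟨
    d * suc s            ≡⟨ cong (d *_) (size-∖ S v Sv) ⟨
    d * size S           <⟨ dense ⟩
    k * degreeSum S      ≡⟨ cong (k *_) (degreeSum-∖ S v Sv) ⟩
    k * (e + 2 * x)      ≡⟨ solve 3 (λ k e x → k :* (e :+ con 2 :* x) := k :* e :+ (con 2 :* k) :* x) refl k e x ⟩
    k * e + (2 * k) * x  ≤⟨ +-monoʳ-≤ (k * e) (<⇒≤ low) ⟩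
    k * e + d            ∎)
    where
    open ≤-Reasoning
    s = size (S ∖ v)
    e = degreeSum (S ∖ v)
    x = degIn G S v

  dense⇒∃-min-degree-⊆ : ∀ k d S → d * size S < k * degreeSum S →
    Σ (VSet n) λ S′ → S′ ⊆ S × NonemptySet S′ × InducedMinDegAtLeastFrac G S′ d k
  dense⇒∃-min-degree-⊆ k d S = peel (size S) S ≤-refl
    where
    peel : ∀ m S → size S ≤ m → d * size S < k * degreeSum S →
           Σ (VSet n) λ S′ → S′ ⊆ S × NonemptySet S′ × InducedMinDegAtLeastFrac G S′ d k
    peel m S size≤m dense with any? (λ v → (S v Bool.≟ true) ×-dec ((2 * k) * degIn G S v <? d))
    ... | no no-low =
      S , (λ _ → id) , dense⇒nonempty k d S dense , λ v Sv → ≮⇒≥ λ low → no-low (v , Sv , low)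
    peel zero    S size≤m dense | yes (v , Sv , low) =
      contradiction (subst (_≤ 0) (size-∖ S v Sv) size≤m) λ ()
    peel (suc m) S size≤m dense | yes (v , Sv , low)
      with peel m (S ∖ v) (s≤s⁻¹ (subst (_≤ suc m) (size-∖ S v Sv) size≤m)) (dense-∖ k d S v Sv low dense)
    ... | S′ , S′⊆S∖v , nonempty , minDeg = S′ , (λ u → ∖-⊆ S v u ∘ S′⊆S∖v u) , nonempty , minDeg

  degreeSum-∑² : ∀ S → degreeSum S ≡ ∑[ a < n ] ∑[ b < n ] (𝟙 (S a) * 𝟙 (S b) * 𝟙 (adj G a b))
  degreeSum-∑² S = sum-cong-≗ λ a →
    trans (cong (𝟙 (S a) *_) (degIn-∑ S a))
          (trans (*-distribˡ-sum (𝟙 (S a)) (λ b → 𝟙 (S b) * 𝟙 (adj G a b)))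
                 (sum-cong-≗ {n} λ b → sym (*-assoc (𝟙 (S a)) (𝟙 (S b)) (𝟙 (adj G a b)))))

  min-degree⇒*≤degreeSum : ∀ {d} → (∀ v → d ≤ deg G v) → n * d ≤ degreeSum (λ _ → true)
  min-degree⇒*≤degreeSum {d} d≤deg = begin
    n * d                           ≡⟨ ∑-const n d ⟨
    ∑[ v < n ] d                    ≤⟨ ∑-mono-≤ d≤deg ⟩
    ∑[ v < n ] deg G v              ≡⟨ sum-cong-≗ (λ v → *-identityˡ (deg G v)) ⟨
    degreeSum (λ _ → true)          ∎
    where open ≤-Reasoning

module TwoColourClasses {n k} (G : Graph n) (c : Fin n → Fin k) (proper : ProperColouring G k c) where

  P : Fin k → Fin k → VSet n
  P i j u = covers i j (c u)

  ⊆P⇒bipartite : ∀ {i j S} → S ⊆ P i j → InducedBipartite G S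
  ⊆P⇒bipartite {i} S⊆P = (λ u → does (c u ≟ i)) , λ u v Su Sv uv same-side →
    proper u v uv (covers-same-side⇒≡ (S⊆P u Su) (S⊆P v Sv) same-side)

  ∑²-size+n≤ : ∑[ i < k ] ∑[ j < k ] size G (P i j) + n ≤ n * (2 * k)
  ∑²-size+n≤ = begin
    ∑[ i < k ] ∑[ j < k ] ∑[ u < n ] 𝟙 (P i j u) + n
      ≡⟨ cong₂ _+_ (∑-comm-∑² λ i j u → 𝟙 (P i j u)) (sym (trans (∑-const n 1) (*-identityʳ n))) ⟩
    ∑[ u < n ] ∑[ i < k ] ∑[ j < k ] 𝟙 (covers i j (c u)) + ∑[ u < n ] 1
      ≡⟨ ∑-distrib-+ (λ u → ∑[ i < k ] ∑[ j < k ] 𝟙 (covers i j (c u))) (λ _ → 1) ⟨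
    ∑[ u < n ] (∑[ i < k ] ∑[ j < k ] 𝟙 (covers i j (c u)) + 1)
      ≤⟨ ∑-mono-≤ (∑²-covers+1≤ ∘ c) ⟩
    ∑[ u < n ] (2 * k)
      ≡⟨ ∑-const n (2 * k) ⟩
    n * (2 * k) ∎
    where open ≤-Reasoning

  2*degreeSum≤∑² : 2 * degreeSum G (λ _ → true) ≤ ∑[ i < k ] ∑[ j < k ] degreeSum G (P i j)
  2*degreeSum≤∑² = begin
    2 * degreeSum G (λ _ → true)
      ≡⟨ trans (cong (2 *_) (degreeSum-∑² G (λ _ → true))) (*-distribˡ-∑² 2 λ a b → 1 * 1 * 𝟙 (adj G a b)) ⟩
    ∑[ a < n ] ∑[ b < n ] (2 * (1 * 1 * 𝟙 (adj G a b)))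
      ≤⟨ ∑-mono-≤ (λ a → ∑-mono-≤ (edge≤ a)) ⟩
    ∑[ a < n ] ∑[ b < n ] ∑[ i < k ] ∑[ j < k ] h i j a b
      ≡⟨ trans (∑-comm-∑² λ i j a → ∑[ b < n ] h i j a b) (sum-cong-≗ λ a → ∑-comm-∑² λ i j b → h i j a b) ⟨
    ∑[ i < k ] ∑[ j < k ] ∑[ a < n ] ∑[ b < n ] h i j a b
      ≡⟨ sum-cong-≗ (λ i → sum-cong-≗ λ j → degreeSum-∑² G (P i j)) ⟨
    ∑[ i < k ] ∑[ j < k ] degreeSum G (P i j) ∎
    where
    open ≤-Reasoning
    h : Fin k → Fin k → Fin n → Fin n → ℕ
    h i j a b = 𝟙 (P i j a) * 𝟙 (P i j b) * 𝟙 (adj G a b)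

    edge≤ : ∀ a b → 2 * (1 * 1 * 𝟙 (adj G a b)) ≤ ∑[ i < k ] ∑[ j < k ] h i j a b
    edge≤ a b with adj G a b in ab
    ... | false = z≤n
    ... | true  = ≤-trans (∑²-covers-both (proper a b ab))
                          (≤-reflexive (sum-cong-≗ {k} λ i → sum-cong-≗ {k} λ j →
                            sym (*-identityʳ (𝟙 (P i j a) * 𝟙 (P i j b)))))

  ∃-dense-pair : ∀ {d} → 0 < d → 0 < n → (∀ v → d ≤ deg G v) →
    ∃₂ λ i j → d * size G (P i j) < k * degreeSum G (P i j)
  ∃-dense-pair {d} 0<d 0<n d≤deg =
    ∑²-<⇒∃-< _ _ (subst₂ _<_ (*-distribˡ-∑² d λ i j → size G (P i j))
                              (*-distribˡ-∑² k λ i j → degreeSum G (P i j)) (begin-strict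
      d * Z                         <⟨ m<m+n (d * Z) (*-mono-< 0<d 0<n) ⟩
      d * Z + d * n                 ≡⟨ *-distribˡ-+ d Z n ⟨
      d * (Z + n)                   ≤⟨ *-monoʳ-≤ d ∑²-size+n≤ ⟩
      d * (n * (2 * k))             ≡⟨ solve 3 (λ d n k → d :* (n :* (con 2 :* k)) := k :* (con 2 :* (n :* d))) refl d n k ⟩
      k * (2 * (n * d))             ≤⟨ *-monoʳ-≤ k (*-monoʳ-≤ 2 (min-degree⇒*≤degreeSum G d≤deg)) ⟩
      k * (2 * degreeSum G (λ _ → true)) ≤⟨ *-monoʳ-≤ k 2*degreeSum≤∑² ⟩
      k * W                         ∎))
    where
    open ≤-Reasoning
    Z = ∑[ i < k ] ∑[ j < k ] size G (P i j)
    W = ∑[ i < k ] ∑[ j < k ] degreeSum G (P i j)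

theorem1p7 : (k : ℕ) → .{{_ : NonZero k}} → (d : ℕ) → (n : ℕ) → (G : Graph n) →
    ChromaticAtMost G k → HasMinDegree G d →
    Σ (VSet n) (λ S → NonemptySet S × InducedBipartite G S × InducedMinDegAtLeastFrac G S d k)
theorem1p7 k zero n G (c , proper) (_ , v , _) =
  P (c v) (c v) , (v , covers-left (c v) (c v)) , ⊆P⇒bipartite (λ _ → id) , λ _ _ → z≤n
  where open TwoColourClasses G c proper
theorem1p7 k d@(suc _) n G (c , proper) (d≤deg , v , _) =
  let i , j , dense                 = ∃-dense-pair z<s (>-nonZero⁻¹ n {{nonZeroIndex v}}) d≤deg
      S , S⊆P , nonempty , minDeg = dense⇒∃-min-degree-⊆ G k d (P i j) dense
  in  S , nonempty , ⊆P⇒bipartite S⊆P , minDeg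
  where open TwoColourClasses G c proper
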